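{- Let $W$ be a non-empty set and let $\mathfrak{A}$ be a family of binary relations on $W$ closed under $\circ$, $\backslash$, $/$ and $\cap$. Suppose $\mathbf{0}_{\mathfrak{A}} \in \mathfrak{A}$ satisfies $\mathbf{0}_{\mathfrak{A}} \subseteq R$ for every $R \in \mathfrak{A}$. Then $\mathbf{0}_{\mathfrak{A}} \circ R = R \circ \mathbf{0}_{\mathfrak{A}} = \mathbf{0}_{\mathfrak{A}}$ for every $R \in \mathfrak{A}$.
   Context: For binary relations $R,S$ on $W$: $R\circ S=\{(x,z) \mid \exists y\in W\,((x,y)\in R \text{ and } (y,z)\in S)\}$; $R\backslash S=\{(y,z)\in W\times W \mid \forall x\in W\,((x,y)\in R\Rightarrow (x,z)\in S)\}$; $S/R=\{(x,y)\in W\times W \mid \forall z\in W\,((y,z)\in R\Rightarrow(x,z)\in S)\}$. -}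

module Defs where

open import Level using (Level; suc; _⊔_)
open import Data.Product using (Σ; _×_; _,_)
open import Relation.Binary.Core using (Rel)

module _ {a : Level} {W : Set a} where

  _∘ᴿ_ : Rel W a → Rel W a → Rel W a
  (R ∘ᴿ S) x z = Σ W (λ y → R x y × S y z)

  _╲ᴿ_ : Rel W a → Rel W a → Rel W a
  (R ╲ᴿ S) y z = ∀ x → R x y → S x z

  _/ᴿ_ : Rel W a → Rel W a → Rel W a
  (S /ᴿ R) x y = ∀ z → R y z → S x z

  _∩ᴿ_ : Rel W a → Rel W a → Rel W a
  (R ∩ᴿ S) x y = R x y × S x y

  _⊆ᴿ_ : Rel W a → Rel W a → Set a
  R ⊆ᴿ S = ∀ x y → R x y → S x y

  _≐ᴿ_ : Rel W a → Rel W a → Set a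
  R ≐ᴿ S = (R ⊆ᴿ S) × (S ⊆ᴿ R)

  record Closed {b : Level} (𝔄 : Rel W a → Set b) : Set (suc a ⊔ b) where
    field
      ∘-closed : ∀ R S → 𝔄 R → 𝔄 S → 𝔄 (R ∘ᴿ S)
      ╲-closed : ∀ R S → 𝔄 R → 𝔄 S → 𝔄 (R ╲ᴿ S)
      /-closed : ∀ R S → 𝔄 R → 𝔄 S → 𝔄 (S /ᴿ R)
      ∩-closed : ∀ R S → 𝔄 R → 𝔄 S → 𝔄 (R ∩ᴿ S)

{-# OPTIONS --safe #-}
-- Composition is residuated: S ∘ R ⊆ T iff S ⊆ T / R, and R ∘ S ⊆ T iff S ⊆ R \ T.
-- As 𝟘 / R and R \ 𝟘 lie in the family, leastness gives 𝟘 ⊆ 𝟘 / R and 𝟘 ⊆ R \ 𝟘,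
-- hence 𝟘 ∘ R ⊆ 𝟘 and R ∘ 𝟘 ⊆ 𝟘; the reverse inclusions are leastness again.
module Submission where

open import Defs
open import Level using (Level)
open import Data.Product using (_×_; _,_)
open import Relation.Binary.Core using (Rel)

module _ {a : Level} {W : Set a} where

  ∘ˡ-⊆-/ᴿ : {R S T : Rel W a} → S ⊆ᴿ (T /ᴿ R) → (S ∘ᴿ R) ⊆ᴿ T
  ∘ˡ-⊆-/ᴿ S⊆T/R x z (y , Sxy , Ryz) = S⊆T/R x y Sxy z Ryz

  ∘ʳ-⊆-╲ᴿ : {R S T : Rel W a} → S ⊆ᴿ (R ╲ᴿ T) → (R ∘ᴿ S) ⊆ᴿ T
  ∘ʳ-⊆-╲ᴿ S⊆R╲T x z (y , Rxy , Syz) = S⊆R╲T y z Syz x Rxy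

  module Least {b : Level} {𝔄 : Rel W a → Set b} (closed : Closed 𝔄)
               {𝟘 : Rel W a} (𝔄𝟘 : 𝔄 𝟘) (least : ∀ R → 𝔄 R → 𝟘 ⊆ᴿ R)
               {R : Rel W a} (𝔄R : 𝔄 R) where

    open Closed closed

    zeroˡ : (𝟘 ∘ᴿ R) ≐ᴿ 𝟘
    zeroˡ = ∘ˡ-⊆-/ᴿ (least (𝟘 /ᴿ R) (/-closed R 𝟘 𝔄R 𝔄𝟘))
          , least (𝟘 ∘ᴿ R) (∘-closed 𝟘 R 𝔄𝟘 𝔄R)

    zeroʳ : (R ∘ᴿ 𝟘) ≐ᴿ 𝟘
    zeroʳ = ∘ʳ-⊆-╲ᴿ (least (R ╲ᴿ 𝟘) (╲-closed R 𝟘 𝔄R 𝔄𝟘))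
          , least (R ∘ᴿ 𝟘) (∘-closed R 𝟘 𝔄R 𝔄𝟘)

lemma2p3 : {a b : Level} (W : Set a) → W → (𝔄 : Rel W a → Set b) → Closed 𝔄 →
    (𝟘 : Rel W a) → 𝔄 𝟘 → (∀ R → 𝔄 R → 𝟘 ⊆ᴿ R) →
    ∀ R → 𝔄 R → ((𝟘 ∘ᴿ R) ≐ᴿ 𝟘) × ((R ∘ᴿ 𝟘) ≐ᴿ 𝟘)
lemma2p3 W _ 𝔄 closed 𝟘 𝔄𝟘 least R 𝔄R = zeroˡ , zeroʳ
  where open Least closed 𝔄𝟘 least 𝔄R
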